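{- For any graph $G$ and any subset $X\subseteq V(G)$, the graph $G-\delta_G(X)$ is a $2\rho_G(X)$-perturbation of $G$.
   Context: $\delta_G(X)$ is the set of edges of $G$ with one end in $X$ and the other in $V(G)\setminus X$, and $G-\delta_G(X)$ is obtained by deleting these edges. The cut-rank $\rho_G(X)$ is the $\mathrm{GF}(2)$-rank of the submatrix of the adjacency matrix of $G$ with rows $X$ and columns $V(G)\setminus X$. Local complementation at $v$ replaces the induced subgraph on $N_G(v)$ by its complement; a vertex-minor of $G$ is an induced subgraph of a graph obtained from $G$ by local complementations. $G_1$ is a $t$-perturbation of $G_2$ if $V(G_1)=V(G_2)$ and some graph on $|V(G_1)|+t$ vertices contains both as vertex-minors. -}

module Defs where

open import Data.Nat using (ℕ; zero; suc; _+_; _≤_)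
open import Data.Bool using (Bool; true; false; _∧_; _xor_; not; if_then_else_)
open import Data.Fin using (Fin; zero; suc; _≟_)
open import Data.List using (List; []; _∷_)
open import Data.Product using (Σ; _×_; Σ-syntax)
open import Relation.Nullary.Decidable using (⌊_⌋)
open import Relation.Binary.PropositionalEquality using (_≡_)
open import Function.Definitions using (Injective)

Adj : ℕ → Set
Adj n = Fin n → Fin n → Bool

IsGraph : ∀ {n} → Adj n → Set
IsGraph {n} a = (∀ (x y : Fin n) → a x y ≡ a y x) × (∀ (x : Fin n) → a x x ≡ false)

record Graph (n : ℕ) : Set where
  field
    adj     : Adj n
    isGraph : IsGraph adj
open Graph public

parity : ∀ {n} → (Fin n → Bool) → Bool
parity {zero}  f = false
parity {suc n} f = f zero xor parity (λ i → f (suc i))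

count : ∀ {n} → (Fin n → Bool) → ℕ
count {zero}  f = 0
count {suc n} f = (if f zero then 1 else 0) + count (λ i → f (suc i))

_⊆_ : ∀ {n} → (Fin n → Bool) → (Fin n → Bool) → Set
_⊆_ {n} S T = ∀ (v : Fin n) → S v ≡ true → T v ≡ true

-- Row of vertex v in the submatrix of the adjacency matrix with rows X and
-- columns V \ X (entry at column w; zero for w ∈ X, i.e. columns outside range).
cutRow : ∀ {n} → Graph n → (Fin n → Bool) → Fin n → Fin n → Bool
cutRow G X v w = adj G v w ∧ not (X w)

-- S ⊆ X is a set of rows of that submatrix that is linearly independent over
-- GF(2): the only subset T ⊆ S whose rows sum to zero is the empty one.
IndepRows : ∀ {n} → Graph n → (Fin n → Bool) → (Fin n → Bool) → Set
IndepRows {n} G X S =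
  (S ⊆ X) ×
  (∀ (T : Fin n → Bool) → T ⊆ S →
     (∀ (w : Fin n) → parity (λ v → T v ∧ cutRow G X v w) ≡ false) →
     ∀ (v : Fin n) → T v ≡ false)

-- ρ_G(X) = k : k is the GF(2)-rank of that submatrix
-- (maximum number of linearly independent rows).
CutRank : ∀ {n} → Graph n → (Fin n → Bool) → ℕ → Set
CutRank {n} G X k =
  (Σ[ S ∈ (Fin n → Bool) ] (IndepRows G X S × count S ≡ k)) ×
  (∀ (S : Fin n → Bool) → IndepRows G X S → count S ≤ k)

-- G - δ_G(X): delete all edges with exactly one end in X.
deleteCut : ∀ {n} → Graph n → (Fin n → Bool) → Adj n
deleteCut G X x y = adj G x y ∧ not (X x xor X y)

-- Local complementation at v: complement the subgraph induced on N(v).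
lc : ∀ {m} → Fin m → Adj m → Adj m
lc v a x y = a x y xor (a v x ∧ a v y ∧ not ⌊ x ≟ y ⌋)

lcs : ∀ {m} → List (Fin m) → Adj m → Adj m
lcs []       a = a
lcs (v ∷ vs) a = lcs vs (lc v a)

-- The graph with adjacency g on Fin n is a vertex-minor of H, where the
-- vertex set of g is identified with a subset of V(H) via ι : it is the
-- subgraph induced on ι(V) of a graph obtained from H by local complementations.
IsVertexMinor : ∀ {n m} → (Fin n → Fin m) → Adj n → Adj m → Set
IsVertexMinor {n} {m} ι g h =
  Σ[ vs ∈ List (Fin m) ] (∀ (i j : Fin n) → g i j ≡ lcs vs h (ι i) (ι j))

-- G₁ is a t-perturbation of G₂ (same vertex set Fin n): some graph H on
-- n + t vertices (containing V as a subset via the injection ι) has both as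
-- vertex-minors.
IsPerturbation : ∀ {n} → ℕ → Adj n → Adj n → Set
IsPerturbation {n} t g₁ g₂ =
  Σ[ h ∈ Adj (n + t) ] (IsGraph h ×
  Σ[ ι ∈ (Fin n → Fin (n + t)) ] (Injective _≡_ _≡_ ι ×
    IsVertexMinor ι g₁ h × IsVertexMinor ι g₂ h))

-- The cut matrix M (rows X, columns V∖X) has rank k, so M = Σₗ aₗ bₗᵀ over GF(2): the bₗ are k independent
-- rows of M, which span all rows by maximality, and aₗ records the coefficient of bₗ in each row. Hence
-- adj G = adj (G - δ_G(X)) + Σₗ (aₗ bₗᵀ + bₗ aₗᵀ). Adding to G - δ_G(X) a new edge pₗqₗ for each l, with pₗ
-- joined to aₗ and qₗ to bₗ, gives a graph H on n + 2k vertices in which these edges form an induced matching.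
-- Pivoting on pₗqₗ adds aₗ bₗᵀ + bₗ aₗᵀ to the adjacency among the other vertices and leaves the other
-- matching edges and their neighbourhoods untouched, so after all k pivots H induces G on the original vertices.

module Submission where

open import Defs
open import Algebra using (CommutativeRing)
open import Data.Bool using (Bool; true; false; _∧_; _∨_; _xor_; not)
open import Data.Bool.Properties
  using (∧-comm; ∧-identityʳ; ∧-zeroʳ; ∨-identityʳ; xor-comm; xor-assoc; xor-identityʳ;
         xor-∧-commutativeRing)
  renaming (_≟_ to _≟ᵇ_)
open import Data.Fin using (Fin; zero; suc; _≟_; _↑ˡ_; _↑ʳ_; splitAt; combine; remQuot)
open import Data.Fin.Patterns using (0F; 1F)
open import Data.Fin.Properties using (all?; suc-injective; splitAt-↑ˡ; splitAt-↑ʳ; remQuot-combine)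
open import Data.Fin.Subset.Properties using (anySubset?)
open import Data.List using (List; []; _∷_)
open import Data.Nat using (ℕ; zero; suc; _+_; _*_; _≤_)
open import Data.Nat.Properties using (n≮n)
open import Data.Sum using (_⊎_; inj₁; inj₂)
open import Data.Sum.Properties using (inj₁-injective)
import Data.Sum as Sum
open import Data.Product using (∃; _×_; _,_; proj₁; proj₂; Σ-syntax)
open import Data.Vec using (lookup; tabulate)
open import Data.Vec.Properties using (lookup∘tabulate)
open import Function using (_∘_)
open import Relation.Binary.PropositionalEquality
  using (_≡_; _≢_; refl; sym; trans; cong; cong₂; subst; module ≡-Reasoning)
open import Relation.Nullary using (¬_; Dec; yes; no; does; contradiction)
open import Relation.Nullary.Decidable using (isYes≗does; dec-true; dec-false; map′; _×-dec_; _→-dec_)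
open import Relation.Unary using (Decidable)

private
  module ⊕ = CommutativeRing xor-∧-commutativeRing

open import Algebra.Properties.CommutativeSemigroup ⊕.+-commutativeSemigroup using (interchange)
open import Algebra.Properties.Group ⊕.+-group using (x∙y⁻¹≈ε⇒x≈y)
open import Algebra.Properties.AbelianGroup ⊕.+-abelianGroup using (xyx⁻¹≈y)

parity-cong : ∀ {n} {f g : Fin n → Bool} → (∀ v → f v ≡ g v) → parity f ≡ parity g
parity-cong {zero}  f≗g = refl
parity-cong {suc n} f≗g = cong₂ _xor_ (f≗g zero) (parity-cong (f≗g ∘ suc))

parity-xor : ∀ {n} (f g : Fin n → Bool) → parity (λ v → f v xor g v) ≡ parity f xor parity g
parity-xor {zero}  f g = refl
parity-xor {suc n} f g = begin
  (f zero xor g zero) xor parity (λ v → f (suc v) xor g (suc v))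
    ≡⟨ cong ((f zero xor g zero) xor_) (parity-xor (f ∘ suc) (g ∘ suc)) ⟩
  (f zero xor g zero) xor (parity (f ∘ suc) xor parity (g ∘ suc))
    ≡⟨ interchange (f zero) (g zero) _ _ ⟩
  (f zero xor parity (f ∘ suc)) xor (g zero xor parity (g ∘ suc)) ∎
  where open ≡-Reasoning

parity-false : ∀ {n} (f : Fin n → Bool) → (∀ v → f v ≡ false) → parity f ≡ false
parity-false {zero}  f f≗0 = refl
parity-false {suc n} f f≗0 = cong₂ _xor_ (f≗0 zero) (parity-false (f ∘ suc) (f≗0 ∘ suc))

parity-indicator : ∀ {n} (x : Fin n) (r : Fin n → Bool) → parity (λ v → does (v ≟ x) ∧ r v) ≡ r x
parity-indicator zero    r =
  trans (cong (r zero xor_) (parity-false (λ v → does (suc v ≟ zero) ∧ r (suc v)) (λ _ → refl)))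
        (xor-identityʳ (r zero))
parity-indicator (suc x) r = parity-indicator x (r ∘ suc)

count-cong : ∀ {n} {S T : Fin n → Bool} → (∀ v → S v ≡ T v) → count S ≡ count T
count-cong {zero}  S≗T = refl
count-cong {suc n} {S} {T} S≗T rewrite S≗T zero = cong (_ +_) (count-cong (S≗T ∘ suc))

insert : ∀ {n} → (Fin n → Bool) → Fin n → Fin n → Bool
insert S x v = S v ∨ does (v ≟ x)

remove : ∀ {n} → (Fin n → Bool) → Fin n → Fin n → Bool
remove T x v = T v ∧ not (does (v ≟ x))

count-insert : ∀ {n} (S : Fin n → Bool) (x : Fin n) → S x ≡ false →
  count (insert S x) ≡ suc (count S)
count-insert S zero    Sx≡false rewrite Sx≡false =
  cong suc (count-cong (λ v → ∨-identityʳ (S (suc v))))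
count-insert S (suc x) Sx≡false with S zero
... | true  = cong suc (count-insert (S ∘ suc) x Sx≡false)
... | false = count-insert (S ∘ suc) x Sx≡false

∈-insert : ∀ {n} {S : Fin n → Bool} {x v} → insert S x v ≡ true → S v ≡ true ⊎ v ≡ x
∈-insert {S = S} {x} {v} v∈ with S v | v ≟ x
... | true  | _      = inj₁ refl
... | false | yes v≡x = inj₂ v≡x

⊆-insert-absent : ∀ {n} {S T : Fin n → Bool} {x} → T ⊆ insert S x → T x ≡ false → T ⊆ S
⊆-insert-absent {S = S} {x = x} T⊆ Tx≡false v Tv with ∈-insert {S = S} {x} (T⊆ v Tv)
... | inj₁ Sv   = Sv
... | inj₂ refl = contradiction (trans (sym Tx≡false) Tv) λ ()

remove-⊆ : ∀ {n} {S T : Fin n → Bool} {x} → T ⊆ insert S x → remove T x ⊆ S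
remove-⊆ {S = S} {T} {x} T⊆ v v∈ with v ≟ x
... | yes refl = contradiction (trans (sym (∧-zeroʳ (T v))) v∈) λ ()
... | no v≢x with ∈-insert {S = S} {x} (T⊆ v (trans (sym (∧-identityʳ (T v))) v∈))
...   | inj₁ Sv  = Sv
...   | inj₂ v≡x = contradiction v≡x v≢x

⊆⇒∧-absorb : ∀ {n} {S T : Fin n → Bool} → T ⊆ S → ∀ v b → S v ∧ (T v ∧ b) ≡ T v ∧ b
⊆⇒∧-absorb {S = S} {T} T⊆S v b with T v in Tv
... | true  rewrite T⊆S v Tv = refl
... | false = ∧-zeroʳ (S v)

parity-remove : ∀ {n} (T f : Fin n → Bool) (x : Fin n) → T x ≡ true →
  parity (λ v → T v ∧ f v) ≡ parity (λ v → remove T x v ∧ f v) xor f x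
parity-remove T f x Tx = begin
  parity (λ v → T v ∧ f v)
    ≡⟨ parity-cong split ⟩
  parity (λ v → (remove T x v ∧ f v) xor (does (v ≟ x) ∧ f v))
    ≡⟨ parity-xor (λ v → remove T x v ∧ f v) (λ v → does (v ≟ x) ∧ f v) ⟩
  parity (λ v → remove T x v ∧ f v) xor parity (λ v → does (v ≟ x) ∧ f v)
    ≡⟨ cong (parity (λ v → remove T x v ∧ f v) xor_) (parity-indicator x f) ⟩
  parity (λ v → remove T x v ∧ f v) xor f x ∎
  where
  open ≡-Reasoning
  split : ∀ v → T v ∧ f v ≡ (remove T x v ∧ f v) xor (does (v ≟ x) ∧ f v)
  split v with v ≟ x
  ... | yes refl rewrite Tx = refl
  ... | no _ = sym (trans (xor-identityʳ _) (cong (_∧ f v) (∧-identityʳ (T v))))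

enumerate : ∀ {n} (S : Fin n → Bool) →
  Σ[ e ∈ (Fin (count S) → Fin n) ] (∀ f → parity (λ v → S v ∧ f v) ≡ parity (f ∘ e))
enumerate {zero}  S = (λ ()) , λ f → refl
enumerate {suc n} S with S zero | enumerate (S ∘ suc)
... | true  | e , sum≡ = (λ { zero → zero ; (suc l) → suc (e l) }) , λ f → cong (f zero xor_) (sum≡ (f ∘ suc))
... | false | e , sum≡ = suc ∘ e , λ f → sum≡ (f ∘ suc)

anyBoolFunction? : ∀ {n} {P : (Fin n → Bool) → Set} → (∀ {S T} → (∀ v → S v ≡ T v) → P S → P T) →
  Decidable P → Dec (∃ P)
anyBoolFunction? {P = P} resp P? = map′
  (λ (S , PS) → lookup S , PS)
  (λ (S , PS) → tabulate S , resp (λ v → sym (lookup∘tabulate S v)) PS)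
  (anySubset? (P? ∘ lookup))

module _ {n} (G : Graph n) (X : Fin n → Bool) where

  private
    row = cutRow G X

  SumsTo : (Fin n → Bool) → Fin n → Set
  SumsTo T x = ∀ w → parity (λ v → T v ∧ row v w) ≡ row x w

  InSpan : (Fin n → Bool) → Fin n → Set
  InSpan S x = ∃ λ T → T ⊆ S × SumsTo T x

  inSpan? : ∀ S x → Dec (InSpan S x)
  inSpan? S x = anyBoolFunction? transport (λ T → ⊆? T ×-dec all? λ w → parity (λ v → T v ∧ row v w) ≟ᵇ row x w)
    where
    ⊆? : ∀ T → Dec (T ⊆ S)
    ⊆? T = all? λ v → (T v ≟ᵇ true) →-dec (S v ≟ᵇ true)
    transport : ∀ {T T′} → (∀ v → T v ≡ T′ v) → T ⊆ S × SumsTo T x → T′ ⊆ S × SumsTo T′ x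
    transport T≗T′ (T⊆S , sum≡) =
      (λ v T′v → T⊆S v (trans (T≗T′ v) T′v)) ,
      (λ w → trans (parity-cong λ v → cong (_∧ row v w) (sym (T≗T′ v))) (sum≡ w))

  independent-insert : ∀ {S x} → IndepRows G X S → X x ≡ true → ¬ InSpan S x →
    IndepRows G X (insert S x)
  independent-insert {S} {x} (S⊆X , indep) Xx x∉span = insert⊆X , indep′
    where
    insert⊆X : insert S x ⊆ X
    insert⊆X v v∈ with ∈-insert {S = S} {x} v∈
    ... | inj₁ Sv   = S⊆X v Sv
    ... | inj₂ refl = Xx
    indep′ : ∀ T → T ⊆ insert S x → (∀ w → parity (λ v → T v ∧ row v w) ≡ false) → ∀ v → T v ≡ false
    indep′ T T⊆ sum≡0 with T x in Tx
    ... | false = indep T (⊆-insert-absent {S = S} T⊆ Tx) sum≡0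
    ... | true  = contradiction (remove T x , remove-⊆ {S = S} T⊆ , sumsTo) x∉span
      where
      sumsTo : SumsTo (remove T x) x
      sumsTo w = x∙y⁻¹≈ε⇒x≈y _ _ (trans (sym (parity-remove T (λ v → row v w) x Tx)) (sum≡0 w))

  maximal-independent-spans : ∀ {S x} → IndepRows G X S →
    (∀ S′ → IndepRows G X S′ → count S′ ≤ count S) → X x ≡ true → InSpan S x
  maximal-independent-spans {S} {x} indS maxS Xx with inSpan? S x
  ... | yes x∈span = x∈span
  ... | no x∉span with S x in Sx
  ...   | true  = contradiction ((λ v → does (v ≟ x)) , singleton⊆ , λ w → parity-indicator x (λ v → row v w)) x∉span
    where
    singleton⊆ : (λ v → does (v ≟ x)) ⊆ S
    singleton⊆ v v≡x with v ≟ x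
    ... | yes refl = Sx
  ...   | false = contradiction (subst (_≤ count S) (count-insert S x Sx) (maxS _ (independent-insert indS Xx x∉span)))
                                (n≮n (count S))

  cutMatrix-factorisation : ∀ {k} → CutRank G X k →
    Σ[ A ∈ (Fin k → Fin n → Bool) ] Σ[ B ∈ (Fin k → Fin n → Bool) ]
      (∀ i j → X i ∧ row i j ≡ parity (λ l → A l i ∧ B l j))
  cutMatrix-factorisation ((S , indS , refl) , maxS) =
    (λ l i → proj₁ (combination i) (e l)) , (λ l j → row (e l) j) , factor
    where
    combination : ∀ x → Σ[ T ∈ (Fin n → Bool) ] (T ⊆ S × ∀ w → parity (λ v → T v ∧ row v w) ≡ X x ∧ row x w)
    combination x with X x in Xx
    ... | true  = maximal-independent-spans indS maxS Xx
    ... | false = (λ _ → false) , (λ _ ()) , λ w → parity-false (λ v → false ∧ row v w) (λ _ → refl)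
    e = proj₁ (enumerate S)
    factor : ∀ i j → X i ∧ row i j ≡ parity (λ l → proj₁ (combination i) (e l) ∧ row (e l) j)
    factor i j = begin
      X i ∧ row i j                              ≡⟨ sym (sum≡ j) ⟩
      parity (λ v → T v ∧ row v j)               ≡⟨ parity-cong (λ v → sym (⊆⇒∧-absorb T⊆S v (row v j))) ⟩
      parity (λ v → S v ∧ (T v ∧ row v j))       ≡⟨ proj₂ (enumerate S) (λ v → T v ∧ row v j) ⟩
      parity (λ l → T (e l) ∧ row (e l) j)       ∎
      where
      open ≡-Reasoning
      T = proj₁ (combination i)
      T⊆S = proj₁ (proj₂ (combination i))
      sum≡ = proj₂ (proj₂ (combination i))

lc-≢ : ∀ {m} (v : Fin m) (a : Adj m) {x y} → x ≢ y → lc v a x y ≡ a x y xor (a v x ∧ a v y)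
lc-≢ v a {x} {y} x≢y rewrite isYes≗does (x ≟ y) | dec-false (x ≟ y) x≢y =
  cong (λ b → a x y xor (a v x ∧ b)) (∧-identityʳ (a v y))

lc-row : ∀ {m} (v : Fin m) (a : Adj m) → a v v ≡ false → ∀ x → lc v a v x ≡ a v x
lc-row v a avv≡false x rewrite avv≡false = xor-identityʳ (a v x)

lc-isGraph : ∀ {m} (v : Fin m) {a : Adj m} → IsGraph a → IsGraph (lc v a)
lc-isGraph v {a} (a-sym , a-loopless) = symmetric , loopless
  where
  symmetric : ∀ x y → lc v a x y ≡ lc v a y x
  symmetric x y = cases (x ≟ y)
    where
    open ≡-Reasoning
    cases : Dec (x ≡ y) → lc v a x y ≡ lc v a y x
    cases (yes refl) = refl
    cases (no x≢y)   = begin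
      lc v a x y                 ≡⟨ lc-≢ v a x≢y ⟩
      a x y xor (a v x ∧ a v y)  ≡⟨ cong₂ _xor_ (a-sym x y) (∧-comm (a v x) (a v y)) ⟩
      a y x xor (a v y ∧ a v x)  ≡⟨ lc-≢ v a (x≢y ∘ sym) ⟨
      lc v a y x                 ∎
  loopless : ∀ x → lc v a x x ≡ false
  loopless x rewrite isYes≗does (x ≟ x) | dec-true (x ≟ x) refl | a-loopless x =
    trans (cong (a v x ∧_) (∧-zeroʳ (a v x))) (∧-zeroʳ (a v x))

lcs-isGraph : ∀ {m} (vs : List (Fin m)) {a : Adj m} → IsGraph a → IsGraph (lcs vs a)
lcs-isGraph []       a-graph = a-graph
lcs-isGraph (v ∷ vs) a-graph = lcs-isGraph vs (lc-isGraph v a-graph)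

pivot : ∀ {m} → Fin m → Fin m → Adj m → Adj m
pivot u v a = lc u (lc v (lc u a))

symProduct : ∀ {m} → (Fin m → Bool) → (Fin m → Bool) → Adj m
symProduct f g x y = (f x ∧ g y) xor (g x ∧ f y)

pivot-identity : ∀ b p q r s →
  ((b xor (p ∧ q)) xor ((r xor p) ∧ (s xor q))) xor (r ∧ s) ≡ b xor ((p ∧ s) xor (r ∧ q))
pivot-identity b p q r s =
  trans (cong (_xor (r ∧ s)) (xor-assoc b _ _)) (trans (xor-assoc b _ _) (cong (b xor_) (table p q r s)))
  where
  table : ∀ p q r s → ((p ∧ q) xor ((r xor p) ∧ (s xor q))) xor (r ∧ s) ≡ (p ∧ s) xor (r ∧ q)
  table false false false false = refl
  table false false false true  = refl
  table false false true  false = refl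
  table false false true  true  = refl
  table false true  false false = refl
  table false true  false true  = refl
  table false true  true  false = refl
  table false true  true  true  = refl
  table true  false false false = refl
  table true  false false true  = refl
  table true  false true  false = refl
  table true  false true  true  = refl
  table true  true  false false = refl
  table true  true  false true  = refl
  table true  true  true  false = refl
  table true  true  true  true  = refl

pivot-≢ : ∀ {m} {a : Adj m} {u v x y} → IsGraph a → a u v ≡ true → x ≢ y →
  x ≢ u → x ≢ v → y ≢ u → y ≢ v → pivot u v a x y ≡ a x y xor symProduct (a u) (a v) x y
pivot-≢ {a = a} {u} {v} {x} {y} a-graph@(_ , a-loopless) auv x≢y x≢u x≢v y≢u y≢v = begin
  pivot u v a x y
    ≡⟨ lc-≢ u a₂ x≢y ⟩
  a₂ x y xor (a₂ u x ∧ a₂ u y)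
    ≡⟨ cong₂ _xor_ (lc-≢ v a₁ x≢y) (cong₂ _∧_ (a₂-u x x≢u x≢v) (a₂-u y y≢u y≢v)) ⟩
  (a₁ x y xor (a₁ v x ∧ a₁ v y)) xor (a v x ∧ a v y)
    ≡⟨ cong (λ c → c xor (a v x ∧ a v y))
            (cong₂ _xor_ (lc-≢ u a x≢y) (cong₂ _∧_ (a₁-v x x≢v) (a₁-v y y≢v))) ⟩
  ((a x y xor (a u x ∧ a u y)) xor ((a v x xor a u x) ∧ (a v y xor a u y))) xor (a v x ∧ a v y)
    ≡⟨ pivot-identity (a x y) (a u x) (a u y) (a v x) (a v y) ⟩
  a x y xor symProduct (a u) (a v) x y ∎
  where
  open ≡-Reasoning
  a₁ = lc u a
  a₂ = lc v a₁
  a₁-v : ∀ z → z ≢ v → a₁ v z ≡ a v z xor a u z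
  a₁-v z z≢v = trans (lc-≢ u a (z≢v ∘ sym)) (cong (λ b → a v z xor (b ∧ a u z)) auv)
  a₁-vu : a₁ v u ≡ true
  a₁-vu = trans (proj₁ (lc-isGraph u a-graph) v u) (trans (lc-row u a (a-loopless u) v) auv)
  a₂-u : ∀ z → z ≢ u → z ≢ v → a₂ u z ≡ a v z
  a₂-u z z≢u z≢v = begin
    a₂ u z                          ≡⟨ lc-≢ v a₁ (z≢u ∘ sym) ⟩
    a₁ u z xor (a₁ v u ∧ a₁ v z)    ≡⟨ cong₂ (λ c d → c xor (d ∧ a₁ v z)) (lc-row u a (a-loopless u) z) a₁-vu ⟩
    a u z xor a₁ v z                ≡⟨ cong (a u z xor_) (a₁-v z z≢v) ⟩
    a u z xor (a v z xor a u z)     ≡⟨ xor-assoc (a u z) (a v z) (a u z) ⟨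
    (a u z xor a v z) xor a u z     ≡⟨ xyx⁻¹≈y (a u z) (a v z) ⟩
    a v z                           ∎

pivot-isGraph : ∀ {m} (u v : Fin m) {a : Adj m} → IsGraph a → IsGraph (pivot u v a)
pivot-isGraph u v a-graph = lc-isGraph u (lc-isGraph v (lc-isGraph u a-graph))

pivot-nonNeighbour : ∀ {m} {a : Adj m} {u v p z} → IsGraph a → a u v ≡ true → a u p ≡ false → a v p ≡ false →
  p ≢ z → p ≢ u → p ≢ v → z ≢ u → z ≢ v → pivot u v a p z ≡ a p z
pivot-nonNeighbour {a = a} {p = p} {z} a-graph auv aup avp p≢z p≢u p≢v z≢u z≢v
  rewrite pivot-≢ a-graph auv p≢z p≢u p≢v z≢u z≢v | aup | avp = xor-identityʳ (a p z)

record IsInducedMatching {m k} (a : Adj m) (end : Fin 2 → Fin k → Fin m) : Set where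
  field
    injective : ∀ {s l s′ l′} → end s l ≡ end s′ l′ → s ≡ s′ × l ≡ l′
    matched   : ∀ l → a (end 0F l) (end 1F l) ≡ true
    induced   : ∀ {l l′} s s′ → l ≢ l′ → a (end s l) (end s′ l′) ≡ false

module _ {m k} {a : Adj m} {end : Fin 2 → Fin (suc k) → Fin m}
         (a-graph : IsGraph a) (M : IsInducedMatching a end) where

  open IsInducedMatching M

  private
    end-≢ : ∀ {s s′ l l′} → l ≢ l′ → end s l ≢ end s′ l′
    end-≢ l≢l′ = l≢l′ ∘ proj₂ ∘ injective

  pivot-row-fixed : ∀ s l {z} → (∀ s′ → z ≢ end s′ 0F) → z ≢ end s (suc l) →
    pivot (end 0F 0F) (end 1F 0F) a (end s (suc l)) z ≡ a (end s (suc l)) z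
  pivot-row-fixed s l z∉ z≢ = pivot-nonNeighbour a-graph (matched 0F) (induced 0F s λ ()) (induced 1F s λ ())
    (z≢ ∘ sym) (end-≢ λ ()) (end-≢ λ ()) (z∉ 0F) (z∉ 1F)

  pivot-isInducedMatching : IsInducedMatching (pivot (end 0F 0F) (end 1F 0F) a) (λ s → end s ∘ suc)
  pivot-isInducedMatching = record
    { injective = λ eq → let s≡s′ , l≡l′ = injective eq in s≡s′ , suc-injective l≡l′
    ; matched   = λ l → trans (pivot-row-fixed 0F l (λ _ → end-≢ λ ()) (λ eq → 1F≢0F (proj₁ (injective eq))))
                              (matched (suc l))
    ; induced   = λ s s′ l≢l′ → trans (pivot-row-fixed s _ (λ _ → end-≢ λ ()) (end-≢ (l≢l′ ∘ sym ∘ suc-injective)))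
                                      (induced s s′ (l≢l′ ∘ suc-injective))
    }
    where
    1F≢0F : 1F ≢ 0F
    1F≢0F ()

matchingPivots : ∀ {m k} → (Fin 2 → Fin k → Fin m) → List (Fin m)
matchingPivots {k = zero}  end = []
matchingPivots {k = suc k} end = end 0F 0F ∷ end 1F 0F ∷ end 0F 0F ∷ matchingPivots (λ s → end s ∘ suc)

matchingPivots-≢ : ∀ {m k} {a : Adj m} {end : Fin 2 → Fin k → Fin m} → IsGraph a → IsInducedMatching a end →
  ∀ {x y} → x ≢ y → (∀ s l → x ≢ end s l) → (∀ s l → y ≢ end s l) →
  lcs (matchingPivots end) a x y ≡ a x y xor parity (λ l → symProduct (a (end 0F l)) (a (end 1F l)) x y)
matchingPivots-≢ {k = zero} {a} _ _ {x} {y} _ _ _ = sym (xor-identityʳ (a x y))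
matchingPivots-≢ {k = suc k} {a} {end} a-graph M {x} {y} x≢y x∉ y∉ = begin
  lcs (matchingPivots end′) a′ x y
    ≡⟨ matchingPivots-≢ (pivot-isGraph u v a-graph) (pivot-isInducedMatching a-graph M) x≢y
                        (λ s → x∉ s ∘ suc) (λ s → y∉ s ∘ suc) ⟩
  a′ x y xor parity (λ l → symProduct (a′ (end′ 0F l)) (a′ (end′ 1F l)) x y)
    ≡⟨ cong₂ _xor_ (pivot-≢ a-graph (matched 0F) x≢y (x∉ 0F 0F) (x∉ 1F 0F) (y∉ 0F 0F) (y∉ 1F 0F))
                   (parity-cong λ l → cong₂ _xor_ (cong₂ _∧_ (fixed x∉ 0F l) (fixed y∉ 1F l))
                                                  (cong₂ _∧_ (fixed x∉ 1F l) (fixed y∉ 0F l))) ⟩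
  (a x y xor symProduct (a u) (a v) x y) xor parity (λ l → symProduct (a (end′ 0F l)) (a (end′ 1F l)) x y)
    ≡⟨ xor-assoc (a x y) _ _ ⟩
  a x y xor parity (λ l → symProduct (a (end 0F l)) (a (end 1F l)) x y) ∎
  where
  open ≡-Reasoning
  open IsInducedMatching M
  u = end 0F 0F
  v = end 1F 0F
  a′ = pivot u v a
  end′ : Fin 2 → Fin k → _
  end′ s = end s ∘ suc
  fixed : ∀ {z} → (∀ s l → z ≢ end s l) → ∀ s l → a′ (end′ s l) z ≡ a (end′ s l) z
  fixed z∉ s l = pivot-row-fixed a-graph M s l (λ s′ → z∉ s′ 0F) (z∉ s (suc l))

does-≟-sym : ∀ {m} (x y : Fin m) → does (x ≟ y) ≡ does (y ≟ x)
does-≟-sym x y with x ≟ y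
... | yes refl = sym (dec-true (x ≟ x) refl)
... | no x≢y   = sym (dec-false (y ≟ x) (x≢y ∘ sym))

module PairExtension {n k} (g : Adj n) (A B : Fin k → Fin n → Bool) where

  side : Fin 2 → Fin k → Fin n → Bool
  side 0F = A
  side 1F = B

  -- (0F , l) and (1F , l) are the ends pₗ and qₗ of the l-th new edge.
  Vertex : Set
  Vertex = Fin n ⊎ (Fin 2 × Fin k)

  adjᵥ : Vertex → Vertex → Bool
  adjᵥ (inj₁ i)       (inj₁ j)         = g i j
  adjᵥ (inj₁ i)       (inj₂ (s , l))   = side s l i
  adjᵥ (inj₂ (s , l)) (inj₁ i)         = side s l i
  adjᵥ (inj₂ (s , l)) (inj₂ (s′ , l′)) = does (l ≟ l′) ∧ not (does (s ≟ s′))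

  vertex : Fin (n + 2 * k) → Vertex
  vertex p = Sum.map₂ (remQuot k) (splitAt n p)

  H : Adj (n + 2 * k)
  H p q = adjᵥ (vertex p) (vertex q)

  ι : Fin n → Fin (n + 2 * k)
  ι i = i ↑ˡ 2 * k

  end : Fin 2 → Fin k → Fin (n + 2 * k)
  end s l = n ↑ʳ combine s l

  vertex-ι : ∀ i → vertex (ι i) ≡ inj₁ i
  vertex-ι i rewrite splitAt-↑ˡ n i (2 * k) = refl

  vertex-end : ∀ s l → vertex (end s l) ≡ inj₂ (s , l)
  vertex-end s l rewrite splitAt-↑ʳ n (2 * k) (combine s l) | remQuot-combine s l = refl

  H-ι-ι : ∀ i j → H (ι i) (ι j) ≡ g i j
  H-ι-ι i j rewrite vertex-ι i | vertex-ι j = refl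

  H-end-ι : ∀ s l i → H (end s l) (ι i) ≡ side s l i
  H-end-ι s l i rewrite vertex-end s l | vertex-ι i = refl

  H-isGraph : IsGraph g → IsGraph H
  H-isGraph (g-sym , g-loopless) = (λ p q → symmetric (vertex p) (vertex q)) , (λ p → loopless (vertex p))
    where
    symmetric : ∀ x y → adjᵥ x y ≡ adjᵥ y x
    symmetric (inj₁ i)       (inj₁ j)         = g-sym i j
    symmetric (inj₁ i)       (inj₂ _)         = refl
    symmetric (inj₂ _)       (inj₁ i)         = refl
    symmetric (inj₂ (s , l)) (inj₂ (s′ , l′)) = cong₂ (λ b c → b ∧ not c) (does-≟-sym l l′) (does-≟-sym s s′)
    loopless : ∀ x → adjᵥ x x ≡ false
    loopless (inj₁ i)       = g-loopless i
    loopless (inj₂ (s , l)) rewrite dec-true (s ≟ s) refl = ∧-zeroʳ (does (l ≟ l))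

  ι-injective : ∀ {i j} → ι i ≡ ι j → i ≡ j
  ι-injective {i} {j} eq = inj₁-injective (trans (sym (vertex-ι i)) (trans (cong vertex eq) (vertex-ι j)))

  ι≢end : ∀ i s l → ι i ≢ end s l
  ι≢end i s l eq with trans (sym (vertex-ι i)) (trans (cong vertex eq) (vertex-end s l))
  ... | ()

  end-isInducedMatching : IsInducedMatching H end
  end-isInducedMatching = record
    { injective = λ {s} {l} {s′} {l′} eq →
        pair-injective (trans (sym (vertex-end s l)) (trans (cong vertex eq) (vertex-end s′ l′)))
    ; matched   = λ l → trans (H-end-end 0F l 1F l) (cong (_∧ true) (dec-true (l ≟ l) refl))
    ; induced   = λ s s′ l≢l′ → trans (H-end-end s _ s′ _) (cong (_∧ not (does (s ≟ s′))) (dec-false (_ ≟ _) l≢l′))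
    }
    where
    pair-injective : ∀ {s l s′ l′} → inj₂ {A = Fin n} (s , l) ≡ inj₂ (s′ , l′) → s ≡ s′ × l ≡ l′
    pair-injective refl = refl , refl
    H-end-end : ∀ s l s′ l′ → H (end s l) (end s′ l′) ≡ does (l ≟ l′) ∧ not (does (s ≟ s′))
    H-end-end s l s′ l′ rewrite vertex-end s l | vertex-end s′ l′ = refl

  perturbation : IsGraph g → (g₂ : Adj n) → IsGraph g₂ →
    (∀ {i j} → i ≢ j → g₂ i j ≡ g i j xor parity (λ l → symProduct (A l) (B l) i j)) →
    IsPerturbation (2 * k) g g₂
  perturbation g-graph g₂ (_ , g₂-loopless) g₂≡ =
    H , H-graph , ι , ι-injective , ([] , λ i j → sym (H-ι-ι i j)) , (matchingPivots end , g₂-minor)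
    where
    H-graph = H-isGraph g-graph
    g₂-minor : ∀ i j → g₂ i j ≡ lcs (matchingPivots end) H (ι i) (ι j)
    g₂-minor i j with i ≟ j
    ... | yes refl = trans (g₂-loopless i) (sym (proj₂ (lcs-isGraph (matchingPivots end) H-graph) (ι i)))
    ... | no i≢j   = sym (begin
      lcs (matchingPivots end) H (ι i) (ι j)
        ≡⟨ matchingPivots-≢ H-graph end-isInducedMatching (i≢j ∘ ι-injective) (ι≢end i) (ι≢end j) ⟩
      H (ι i) (ι j) xor parity (λ l → symProduct (H (end 0F l)) (H (end 1F l)) (ι i) (ι j))
        ≡⟨ cong₂ _xor_ (H-ι-ι i j) (parity-cong λ l →
             cong₂ _xor_ (cong₂ _∧_ (H-end-ι 0F l i) (H-end-ι 1F l j)) (cong₂ _∧_ (H-end-ι 1F l i) (H-end-ι 0F l j))) ⟩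
      g i j xor parity (λ l → symProduct (A l) (B l) i j)
        ≡⟨ g₂≡ i≢j ⟨
      g₂ i j ∎)
      where open ≡-Reasoning

deleteCut-isGraph : ∀ {n} (G : Graph n) (X : Fin n → Bool) → IsGraph (deleteCut G X)
deleteCut-isGraph G X =
  (λ x y → cong₂ (λ b c → b ∧ not c) (proj₁ (isGraph G) x y) (xor-comm (X x) (X y))) ,
  (λ x → cong (_∧ not (X x xor X x)) (proj₂ (isGraph G) x))

adj≡deleteCut-xor-cuts : ∀ {n} (G : Graph n) (X : Fin n → Bool) i j →
  adj G i j ≡ deleteCut G X i j xor ((X i ∧ cutRow G X i j) xor (X j ∧ cutRow G X j i))
adj≡deleteCut-xor-cuts G X i j rewrite proj₁ (isGraph G) j i = table (adj G i j) (X i) (X j)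
  where
  table : ∀ a x y → a ≡ (a ∧ not (x xor y)) xor ((x ∧ (a ∧ not y)) xor (y ∧ (a ∧ not x)))
  table false false false = refl
  table false false true  = refl
  table false true  false = refl
  table false true  true  = refl
  table true  false false = refl
  table true  false true  = refl
  table true  true  false = refl
  table true  true  true  = refl

adj-decomposition : ∀ {n k} (G : Graph n) (X : Fin n → Bool) (A B : Fin k → Fin n → Bool) →
  (∀ i j → X i ∧ cutRow G X i j ≡ parity (λ l → A l i ∧ B l j)) →
  ∀ i j → adj G i j ≡ deleteCut G X i j xor parity (λ l → symProduct (A l) (B l) i j)
adj-decomposition G X A B factor i j = begin
  adj G i j
    ≡⟨ adj≡deleteCut-xor-cuts G X i j ⟩
  deleteCut G X i j xor ((X i ∧ cutRow G X i j) xor (X j ∧ cutRow G X j i))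
    ≡⟨ cong (deleteCut G X i j xor_) (cong₂ _xor_ (factor i j) (factor j i)) ⟩
  deleteCut G X i j xor (parity (λ l → A l i ∧ B l j) xor parity (λ l → A l j ∧ B l i))
    ≡⟨ cong (deleteCut G X i j xor_) (parity-xor (λ l → A l i ∧ B l j) (λ l → A l j ∧ B l i)) ⟨
  deleteCut G X i j xor parity (λ l → (A l i ∧ B l j) xor (A l j ∧ B l i))
    ≡⟨ cong (deleteCut G X i j xor_) (parity-cong λ l → cong ((A l i ∧ B l j) xor_) (∧-comm (A l j) (B l i))) ⟩
  deleteCut G X i j xor parity (λ l → symProduct (A l) (B l) i j) ∎
  where open ≡-Reasoning

lemma3p3 : ∀ {n : ℕ} (G : Graph n) (X : Fin n → Bool) (k : ℕ) →
    CutRank G X k → IsPerturbation (2 * k) (deleteCut G X) (adj G)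
lemma3p3 G X k ρ =
  let A , B , factor = cutMatrix-factorisation G X ρ
  in PairExtension.perturbation (deleteCut G X) A B (deleteCut-isGraph G X) (adj G) (isGraph G)
       (λ {i} {j} _ → adj-decomposition G X A B factor i j)
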